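{- Let $n\geq 1$, let $U_{6n}=\langle a,b\mid a^{2n}=b^3=1,\ a^{ -1}ba=b^{ -1}\rangle$, and let $\Gamma=\Gamma(U_{6n})$ be its non-commuting graph. Then the detour index polynomial of $\Gamma$ is $D(\Gamma,x)=\frac{5n(5n-1)}{2}x^{5n-1}$.
   Context: The group $U_{6n}$ has order $6n$ and center $Z(U_{6n})=\langle a^2\rangle$. For a finite group $G$, the non-commuting graph $\Gamma(G)$ has vertex set $G\setminus Z(G)$, and two distinct vertices $x,y$ are adjacent iff $xy\neq yx$. The detour distance $D(u,v)$ is the length of a longest simple path from $u$ to $v$, and the detour index polynomial is $D(\Gamma,x)=\sum_{\{u,v\}}x^{D(u,v)}$, the sum over unordered pairs of distinct vertices of $\Gamma$. -}

module Defs where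

open import Data.Nat using (ℕ; zero; suc; _+_; _*_; _∸_; _<_; _≤_)
open import Data.Nat.DivMod using (_mod_)
open import Data.Fin using (Fin; toℕ)
open import Data.Product using (_×_; _,_; ∃; Σ)
open import Data.List using (List; []; _∷_; length)
open import Data.List.Relation.Unary.All using (All)
open import Data.List.Relation.Unary.Unique.Propositional using (Unique)
open import Data.List.Membership.Propositional using (_∈_)
open import Relation.Binary.PropositionalEquality using (_≡_; _≢_)
open import Relation.Nullary using (¬_)
open import Function.Bundles using (_⇔_)

-- Addition modulo m on Fin m (m is necessarily nonzero when Fin m is inhabited).
addF : ∀ {m} → Fin m → Fin m → Fin m
addF {suc m} i j = (toℕ i + toℕ j) mod (suc m)

-- Elements of U_{6n}: the element el i j stands for a^i b^j, with 0 ≤ i < 2n, 0 ≤ j < 3.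
record U (n : ℕ) : Set where
  constructor el
  field
    apow : Fin (2 * n)
    bpow : Fin 3

-- From a^{-1} b a = b^{-1}:  b^j a^k = a^k b^{(-1)^k j}, hence
-- (a^i b^j)(a^k b^l) = a^{i+k} b^{(-1)^k j + l}, and b^{-1} = b^2.
signPow : ℕ → Fin 3 → Fin 3
signPow zero          j = j
signPow (suc zero)    j = addF j j
signPow (suc (suc k)) j = signPow k j

mul : ∀ {n} → U n → U n → U n
mul (el i j) (el k l) = el (addF i k) (addF (signPow (toℕ k) j) l)

Commute : ∀ {n} → U n → U n → Set
Commute g h = mul g h ≡ mul h g

Central : ∀ {n} → U n → Set
Central {n} g = ∀ (h : U n) → Commute g h

Vertex : ∀ {n} → U n → Set
Vertex g = ¬ Central g

Adj : ∀ {n} → U n → U n → Set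
Adj g h = Vertex g × Vertex h × g ≢ h × ¬ Commute g h

data Walk {n : ℕ} : U n → U n → List (U n) → Set where
  stop : ∀ {x} → Walk x x (x ∷ [])
  step : ∀ {x y z ps} → Adj x y → Walk y z ps → Walk x z (x ∷ ps)

Path : ∀ {n} → U n → U n → List (U n) → Set
Path u v ps = Walk u v ps × Unique ps × All Vertex ps

pathLength : ∀ {A : Set} → List A → ℕ
pathLength ps = length ps ∸ 1

DetourDist : ∀ {n} → U n → U n → ℕ → Set
DetourDist u v d =
  (∃ λ ps → Path u v ps × pathLength ps ≡ d) ×
  (∀ ps → Path u v ps → pathLength ps ≤ d)

-- A fixed linear order on U_{6n}, used to enumerate unordered pairs once.
rank : ∀ {n} → U n → ℕ
rank (el i j) = toℕ i * 3 + toℕ j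

-- Unordered pairs {u,v} of distinct vertices of Γ, represented as (u , v) with rank u < rank v.
VertexPair : ∀ {n} → U n × U n → Set
VertexPair (u , v) = Vertex u × Vertex v × rank u < rank v

-- The coefficient of x^k in the detour index polynomial D(Γ(U_{6n}), x) is c:
-- the number of unordered pairs {u,v} of distinct vertices with D(u,v) = k equals c.
DetourCoeff : ℕ → ℕ → ℕ → Set
DetourCoeff n k c =
  Σ (List (U n × U n)) λ L →
    Unique L × length L ≡ c ×
    (∀ p → (p ∈ L) ⇔ (VertexPair p × DetourDist (Data.Product.proj₁ p) (Data.Product.proj₂ p) k))

-- The non-central elements of U_{6n} are the a^i b^j with i odd or j ≠ 0. Writing i = 2k + r, such an
-- element is determined by its block k < n and its colour (r , j), one of five; whether two elements
-- commute depends only on their colours, and the colour graph is K₅ minus the edge {a^{2k} b, a^{2k} b²}.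
-- So Γ is the complete multipartite graph K_{2n,n,n,n}. It is Hamilton-connected: a path from u to v
-- starts inside the block of u, runs through every other block in one fixed colour order, and finishes
-- inside the block of v; the parts inside the first and last block come from a finite table. Hence
-- every detour distance equals 5n − 1, and all C(5n, 2) pairs of vertices contribute to x^{5n−1}.

module Submission where

open import Defs
open import Data.Nat using (ℕ; zero; suc; _+_; _*_; _∸_; _/_; _≤_; _<_; s≤s; z≤n)
open import Data.Product using (_×_; _,_; proj₁; proj₂; ∃; ∃₂)
import Data.Nat.Properties as ℕ
open import Data.Nat.DivMod using (_mod_; m*n/n≡m)
open import Data.Nat.Combinatorics using (_C_; nCk+nC[k+1]≡[n+1]C[k+1]; nC1≡n)
open import Data.Nat.Tactic.RingSolver using (solve-∀)
open import Data.Fin as F using (Fin; toℕ; cast; combine; remQuot; punchIn; punchOut)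
import Data.Fin.Properties as F
open import Data.Fin.Patterns using (0F; 1F; 2F)
import Data.Product.Properties as Product
open import Data.Sum using (_⊎_; inj₁; inj₂; [_,_]′; map₁)
open import Data.Maybe using (just)
import Data.Maybe as Maybe
import Data.Maybe.Properties as Maybe
open import Data.Maybe.Relation.Binary.Connected using (Connected; just; just-nothing; nothing-just; nothing; connected?)
open import Data.List using (List; []; _∷_; _++_; map; length; head; last; allFin; cartesianProduct)
import Data.List.Properties as List
open import Data.List.Membership.Propositional using (_∈_; _∉_)
import Data.List.Membership.Propositional.Properties as ∈
open import Data.List.Relation.Unary.Any using (here; there)
open import Data.List.Relation.Unary.All as All using (All; all?)
import Data.List.Relation.Unary.All.Properties as All
open import Data.List.Relation.Unary.AllPairs as AllPairs using (AllPairs; []; _∷_; allPairs?)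
import Data.List.Relation.Unary.AllPairs.Properties as AllPairs
open import Data.List.Relation.Unary.Linked as Linked using (Linked; [-]; _∷_; linked?)
import Data.List.Relation.Unary.Linked.Properties as Linked
open import Data.List.Relation.Unary.Unique.Propositional using (Unique)
import Data.List.Relation.Unary.Unique.Propositional.Properties as Unique
open import Data.List.Relation.Binary.Disjoint.Propositional using (Disjoint)
open import Data.List.Relation.Binary.Subset.Propositional using (_⊆_)
open import Data.Empty using (⊥-elim)
open import Function using (_on_; _∘_)
open import Function.Bundles using (mk⇔)
open import Relation.Binary.Core using (Rel)
open import Relation.Binary.Definitions using (DecidableEquality; Decidable; Asymmetric)
open import Relation.Binary.PropositionalEquality using (_≡_; _≢_; refl; sym; trans; cong; cong₂; subst; subst₂; module ≡-Reasoning)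
open import Relation.Nullary using (¬_; Dec; yes; no; ¬?)
open import Relation.Nullary.Decidable using (map′; toWitness; _×-dec_; _⊎-dec_)

-- Colours and blocks

data Colour : Set where
  even₁ even₂ odd₀ odd₁ odd₂ : Colour

aParity : Colour → Fin 2
aParity even₁ = 0F
aParity even₂ = 0F
aParity _     = 1F

bExp : Colour → Fin 3
bExp even₁ = 1F
bExp even₂ = 2F
bExp odd₀  = 0F
bExp odd₁  = 1F
bExp odd₂  = 2F

-- (0F , 0F) is the colour of the central elements; its image is junk.
colourOf : Fin 2 → Fin 3 → Colour
colourOf 0F 2F = even₂
colourOf 0F _  = even₁
colourOf 1F 0F = odd₀
colourOf 1F 1F = odd₁
colourOf 1F 2F = odd₂

colourOf-inverse : ∀ c → colourOf (aParity c) (bExp c) ≡ c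
colourOf-inverse even₁ = refl
colourOf-inverse even₂ = refl
colourOf-inverse odd₀  = refl
colourOf-inverse odd₁  = refl
colourOf-inverse odd₂  = refl

colour-injective : ∀ {c d} → aParity c ≡ aParity d → bExp c ≡ bExp d → c ≡ d
colour-injective {c} {d} p b =
  trans (sym (colourOf-inverse c)) (trans (cong₂ colourOf p b) (colourOf-inverse d))

_≟_ : DecidableEquality Colour
c ≟ d = map′ (λ eq → colour-injective (cong proj₁ eq) (cong proj₂ eq)) (cong (λ e → aParity e , bExp e))
  (Product.≡-dec F._≟_ F._≟_ (aParity c , bExp c) (aParity d , bExp d))

open import Data.List.Relation.Unary.Unique.DecPropositional _≟_ using (unique?)
open import Data.List.Relation.Binary.Disjoint.DecPropositional _≟_ using (disjoint?)

colours : List Colour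
colours = even₁ ∷ even₂ ∷ odd₀ ∷ odd₁ ∷ odd₂ ∷ []

∈-colours : ∀ c → c ∈ colours
∈-colours even₁ = here refl
∈-colours even₂ = there (here refl)
∈-colours odd₀  = there (there (here refl))
∈-colours odd₁  = there (there (there (here refl)))
∈-colours odd₂  = there (there (there (there (here refl))))

Node : ℕ → Set
Node n = Fin n × Colour

aIndex : ∀ {n} → Fin n → Fin 2 → Fin (2 * n)
aIndex {n} k r = cast (ℕ.*-comm n 2) (combine k r)

toℕ-aIndex : ∀ {n} (k : Fin n) r → toℕ (aIndex k r) ≡ 2 * toℕ k + toℕ r
toℕ-aIndex {n} k r = trans (F.toℕ-cast (ℕ.*-comm n 2) (combine k r)) (F.toℕ-combine k r)

aIndex-injective : ∀ {n} {k l : Fin n} {r s} → aIndex k r ≡ aIndex l s → k ≡ l × r ≡ s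
aIndex-injective {n} {k} {l} {r} {s} eq = Product.,-injective (begin
  (k , r)                  ≡⟨ F.remQuot-combine k r ⟨
  remQuot 2 (combine k r)  ≡⟨ cong (remQuot 2) (F.toℕ-injective combine-eq) ⟩
  remQuot 2 (combine l s)  ≡⟨ F.remQuot-combine l s ⟩
  (l , s)                  ∎)
  where
  open ≡-Reasoning
  combine-eq : toℕ (combine k r) ≡ toℕ (combine l s)
  combine-eq = trans (sym (F.toℕ-cast (ℕ.*-comm n 2) (combine k r)))
                     (trans (cong toℕ eq) (F.toℕ-cast (ℕ.*-comm n 2) (combine l s)))

aIndex-surjective : ∀ {n} (i : Fin (2 * n)) → ∃₂ λ k r → aIndex k r ≡ i
aIndex-surjective {n} i = proj₁ kr , proj₂ kr , (begin
  cast (ℕ.*-comm n 2) (combine (proj₁ kr) (proj₂ kr))  ≡⟨ cong (cast (ℕ.*-comm n 2)) (F.combine-remQuot {n} 2 i′) ⟩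
  cast (ℕ.*-comm n 2) i′                               ≡⟨ F.cast-involutive (ℕ.*-comm n 2) (sym (ℕ.*-comm n 2)) i ⟩
  i                                                    ∎)
  where
  open ≡-Reasoning
  i′ = cast (sym (ℕ.*-comm n 2)) i
  kr = remQuot {n} 2 i′

embed : ∀ {n} → Node n → U n
embed (k , c) = el (aIndex k (aParity c)) (bExp c)

embed-injective : ∀ {n} {x y : Node n} → embed x ≡ embed y → x ≡ y
embed-injective {x = k , c} {l , d} eq
  with refl , p ← aIndex-injective {k = k} {l} {aParity c} {aParity d} (cong U.apow eq)
  = cong (k ,_) (colour-injective p (cong U.bpow eq))

-- Commutation in U_{6n}

signPow-2*+ : ∀ k t (j : Fin 3) → signPow (2 * k + t) j ≡ signPow t j
signPow-2*+ zero    t j = refl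
signPow-2*+ (suc k) t j = begin
  signPow (2 * suc k + t) j  ≡⟨ cong (λ e → signPow (e + t) j) (ℕ.*-suc 2 k) ⟩
  signPow (2 + 2 * k + t) j  ≡⟨ signPow-2*+ k t j ⟩
  signPow t j                ∎
  where open ≡-Reasoning

signPow-aIndex : ∀ {n} (k : Fin n) r j → signPow (toℕ (aIndex k r)) j ≡ signPow (toℕ r) j
signPow-aIndex k r j = trans (cong (λ e → signPow e j) (toℕ-aIndex k r)) (signPow-2*+ (toℕ k) (toℕ r) j)

signPow-zero : ∀ t → signPow t 0F ≡ 0F
signPow-zero zero          = refl
signPow-zero (suc zero)    = refl
signPow-zero (suc (suc t)) = signPow-zero t

addF-comm : ∀ {m} (i j : Fin m) → addF i j ≡ addF j i
addF-comm {suc m} i j = cong (_mod suc m) (ℕ.+-comm (toℕ i) (toℕ j))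

-- The b-exponents of the two products; their a-exponents always agree.
ColoursCommute : Colour → Colour → Set
ColoursCommute c d =
  addF (signPow (toℕ (aParity d)) (bExp c)) (bExp d) ≡ addF (signPow (toℕ (aParity c)) (bExp d)) (bExp c)

Edge : Colour → Colour → Set
Edge c d = ¬ ColoursCommute c d

edge? : Decidable Edge
edge? c d = ¬? (_ F.≟ _)

commute⇒coloursCommute : ∀ {n} {k l : Fin n} {c d} → Commute (embed (k , c)) (embed (l , d)) → ColoursCommute c d
commute⇒coloursCommute {k = k} {l} {c} {d} eq =
  subst₂ (λ s t → addF s (bExp d) ≡ addF t (bExp c))
    (signPow-aIndex l (aParity d) (bExp c)) (signPow-aIndex k (aParity c) (bExp d)) (cong U.bpow eq)

even-central : ∀ {n} (k : Fin n) → Central (el (aIndex k 0F) 0F)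
even-central {n} k (el i j) = cong₂ (el {n}) (addF-comm (aIndex k 0F) i) (begin
  addF (signPow (toℕ i) 0F) j               ≡⟨ cong (λ s → addF s j) (signPow-zero (toℕ i)) ⟩
  addF 0F j                                 ≡⟨ addF-comm 0F j ⟩
  addF j 0F                                 ≡⟨ cong (λ s → addF s 0F) (signPow-aIndex k 0F j) ⟨
  addF (signPow (toℕ (aIndex k 0F)) j) 0F   ∎)
  where open ≡-Reasoning

partner : Colour → Colour
partner even₁ = odd₀
partner even₂ = odd₀
partner _     = even₁

partner-edge : ∀ c → Edge c (partner c)
partner-edge even₁ ()
partner-edge even₂ ()
partner-edge odd₀  ()
partner-edge odd₁  ()
partner-edge odd₂  ()

embed-vertex : ∀ {n} (x : Node n) → Vertex (embed x)
embed-vertex (k , c) central = partner-edge c (commute⇒coloursCommute (central (embed (k , partner c))))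

embed-adjacent : ∀ {n} {k l : Fin n} {c d} → Edge c d → Adj (embed (k , c)) (embed (l , d))
embed-adjacent {k = k} {l} {c} {d} e =
  embed-vertex (k , c) , embed-vertex (l , d) ,
  (λ eq → noncommuting (subst (Commute (embed (k , c))) eq refl)) , noncommuting
  where
  noncommuting : ¬ Commute (embed (k , c)) (embed (l , d))
  noncommuting = e ∘ commute⇒coloursCommute

embed-surjective : ∀ {n} {g : U n} → Vertex g → ∃ λ x → embed x ≡ g
embed-surjective {n} {el i j} noncentral with aIndex-surjective {n} i
... | k , 0F , refl with j
...   | 0F = ⊥-elim (noncentral (even-central {n} k))
...   | 1F = (k , even₁) , refl
...   | 2F = (k , even₂) , refl
embed-surjective {n} {el i j} noncentral | k , 1F , refl with j
...   | 0F = (k , odd₀) , refl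
...   | 1F = (k , odd₁) , refl
...   | 2F = (k , odd₂) , refl

-- List combinatorics

linked⇒walk : ∀ {n} {g h : U n} {gs} → Linked Adj gs → head gs ≡ just g → last gs ≡ just h → Walk g h gs
linked⇒walk {gs = _ ∷ []}    [-]       refl refl = stop
linked⇒walk {gs = _ ∷ _ ∷ _} (adj ∷ l) refl eq   = step adj (linked⇒walk l refl eq)

module _ {A : Set} where

  last-++ : ∀ (xs : List A) {ys y} → last ys ≡ just y → last (xs ++ ys) ≡ just y
  last-++ []            eq = eq
  last-++ (x ∷ [])      {_ ∷ _} eq = eq
  last-++ (x ∷ x′ ∷ xs) eq = last-++ (x′ ∷ xs) eq

  Unique⇒length-mono-⊆ : {xs ys : List A} → Unique xs → xs ⊆ ys → length xs ≤ length ys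
  Unique⇒length-mono-⊆ {[]}     _          _   = z≤n
  Unique⇒length-mono-⊆ {x ∷ xs} (x∉xs ∷ u) sub with ∈.∈-∃++ (sub (here refl))
  ... | ys₁ , ys₂ , refl = begin
    suc (length xs)                ≤⟨ s≤s (Unique⇒length-mono-⊆ u sub′) ⟩
    suc (length (ys₁ ++ ys₂))      ≡⟨ cong suc (List.length-++ ys₁) ⟩
    suc (length ys₁ + length ys₂)  ≡⟨ ℕ.+-suc (length ys₁) (length ys₂) ⟨
    length ys₁ + length (x ∷ ys₂)  ≡⟨ List.length-++ ys₁ ⟨
    length (ys₁ ++ x ∷ ys₂)        ∎
    where
    open ℕ.≤-Reasoning
    skip : ∀ zs {y} → y ∈ zs ++ x ∷ ys₂ → y ≢ x → y ∈ zs ++ ys₂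
    skip []       (here refl) y≢x = ⊥-elim (y≢x refl)
    skip []       (there p)   _   = p
    skip (_ ∷ zs) (here refl) _   = here refl
    skip (_ ∷ zs) (there p)   y≢x = there (skip zs p y≢x)
    sub′ : xs ⊆ ys₁ ++ ys₂
    sub′ y∈xs = skip ys₁ (sub (there y∈xs)) (λ { refl → All.lookup x∉xs y∈xs refl })

  pairs : List A → List (A × A)
  pairs []       = []
  pairs (x ∷ xs) = map (x ,_) xs ++ pairs xs

  length-pairs : ∀ xs → length (pairs xs) ≡ length xs C 2
  length-pairs []       = refl
  length-pairs (x ∷ xs) = begin
    length (map (x ,_) xs ++ pairs xs)          ≡⟨ List.length-++ (map (x ,_) xs) ⟩
    length (map (x ,_) xs) + length (pairs xs)  ≡⟨ cong₂ _+_ (List.length-map (x ,_) xs) (length-pairs xs) ⟩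
    length xs + length xs C 2                   ≡⟨ cong (_+ length xs C 2) (nC1≡n (length xs)) ⟨
    length xs C 1 + length xs C 2               ≡⟨ nCk+nC[k+1]≡[n+1]C[k+1] (length xs) 1 ⟩
    suc (length xs) C 2                         ∎
    where open ≡-Reasoning

  module _ {ℓ} {R : Rel A ℓ} where

    ∈-pairs⁻ : ∀ {xs u v} → AllPairs R xs → (u , v) ∈ pairs xs → u ∈ xs × v ∈ xs × R u v
    ∈-pairs⁻ {x ∷ xs} (Rx ∷ Rxs) p with ∈.∈-++⁻ (map (x ,_) xs) p
    ... | inj₁ q with _ , v∈xs , refl ← ∈.∈-map⁻ (x ,_) q = here refl , there v∈xs , All.lookup Rx v∈xs
    ... | inj₂ q with u∈xs , v∈xs , Ruv ← ∈-pairs⁻ Rxs q  = there u∈xs , there v∈xs , Ruv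

    module _ (asym : Asymmetric R) where

      ∈-pairs⁺ : ∀ {xs u v} → AllPairs R xs → u ∈ xs → v ∈ xs → R u v → (u , v) ∈ pairs xs
      ∈-pairs⁺ {x ∷ xs} _          (here refl) (here refl) Ruv = ⊥-elim (asym Ruv Ruv)
      ∈-pairs⁺ {x ∷ xs} _          (here refl) (there v∈) _    = ∈.∈-++⁺ˡ (∈.∈-map⁺ (x ,_) v∈)
      ∈-pairs⁺ {x ∷ xs} (Rx ∷ _)   (there u∈) (here refl) Ruv  = ⊥-elim (asym Ruv (All.lookup Rx u∈))
      ∈-pairs⁺ {x ∷ xs} (_ ∷ Rxs)  (there u∈) (there v∈) Ruv   = ∈.∈-++⁺ʳ (map (x ,_) xs) (∈-pairs⁺ Rxs u∈ v∈ Ruv)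

      pairs-unique : ∀ {xs} → AllPairs R xs → Unique (pairs xs)
      pairs-unique {[]}     []         = []
      pairs-unique {x ∷ xs} (Rx ∷ Rxs) =
        Unique.++⁺ (Unique.map⁺ (cong proj₂) (AllPairs.map R⇒≢ Rxs)) (pairs-unique Rxs) disjoint
        where
        R⇒≢ : ∀ {u v} → R u v → u ≢ v
        R⇒≢ Ruv refl = asym Ruv Ruv
        disjoint : Disjoint (map (x ,_) xs) (pairs xs)
        disjoint (p∈ , p∈pairs) with _ , _ , refl ← ∈.∈-map⁻ (x ,_) p∈ =
          R⇒≢ (All.lookup Rx (proj₁ (∈-pairs⁻ Rxs p∈pairs))) refl

nC2*2≡n*[n∸1] : ∀ n → (n C 2) * 2 ≡ n * (n ∸ 1)
nC2*2≡n*[n∸1] zero    = refl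
nC2*2≡n*[n∸1] (suc n) = begin
  (suc n C 2) * 2          ≡⟨ cong (_* 2) (nCk+nC[k+1]≡[n+1]C[k+1] n 1) ⟨
  (n C 1 + n C 2) * 2      ≡⟨ cong (λ e → (e + n C 2) * 2) (nC1≡n n) ⟩
  (n + n C 2) * 2          ≡⟨ ℕ.*-distribʳ-+ 2 n (n C 2) ⟩
  n * 2 + (n C 2) * 2      ≡⟨ cong (n * 2 +_) (nC2*2≡n*[n∸1] n) ⟩
  n * 2 + n * (n ∸ 1)      ≡⟨ regroup n ⟩
  suc n * n                ∎
  where
  open ≡-Reasoning
  regroup : ∀ n → n * 2 + n * (n ∸ 1) ≡ suc n * n
  regroup zero    = refl
  regroup (suc k) = identity k
    where
    identity : ∀ k → suc k * 2 + suc k * k ≡ suc (suc k) * suc k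
    identity = solve-∀

module _ {A B : Set} where

  length-cartesianProduct : ∀ (xs : List A) (ys : List B) → length (cartesianProduct xs ys) ≡ length xs * length ys
  length-cartesianProduct []       ys = refl
  length-cartesianProduct (x ∷ xs) ys = begin
    length (map (x ,_) ys ++ cartesianProduct xs ys)          ≡⟨ List.length-++ (map (x ,_) ys) ⟩
    length (map (x ,_) ys) + length (cartesianProduct xs ys)  ≡⟨ cong₂ _+_ (List.length-map (x ,_) ys) (length-cartesianProduct xs ys) ⟩
    length ys + length xs * length ys                         ∎
    where open ≡-Reasoning

  AllPairs-cartesianProduct⁺ : ∀ {ℓ₁ ℓ₂ ℓ} {R₁ : Rel A ℓ₁} {R₂ : Rel B ℓ₂} {R : Rel (A × B) ℓ} →
    (∀ {a a′ b b′} → R₁ a a′ → R (a , b) (a′ , b′)) → (∀ {a b b′} → R₂ b b′ → R (a , b) (a , b′)) →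
    ∀ {xs ys} → AllPairs R₁ xs → AllPairs R₂ ys → AllPairs R (cartesianProduct xs ys)
  AllPairs-cartesianProduct⁺ across within {[]}     []           _    = []
  AllPairs-cartesianProduct⁺ {R = R} across within {x ∷ xs} {ys} (R₁x ∷ R₁xs) R₂ys =
    AllPairs.++⁺ (AllPairs.map⁺ (AllPairs.map within R₂ys))
                 (AllPairs-cartesianProduct⁺ across within R₁xs R₂ys)
                 (All.tabulate λ p∈ → All.tabulate λ q∈ → later p∈ q∈)
    where
    later : ∀ {p q} → p ∈ map (x ,_) ys → q ∈ cartesianProduct xs ys → R p q
    later p∈ q∈ with _ , _ , refl ← ∈.∈-map⁻ (x ,_) p∈ = across (All.lookup R₁x (proj₁ (∈.∈-cartesianProduct⁻ xs ys q∈)))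

allFinExcept : ∀ {n} → Fin n → List (Fin n)
allFinExcept {suc n} j = map (punchIn j) (allFin n)

allFinExcept-unique : ∀ {n} (j : Fin n) → Unique (allFinExcept j)
allFinExcept-unique {suc n} j = Unique.map⁺ (F.punchIn-injective j _ _) (Unique.allFin⁺ n)

∉-allFinExcept : ∀ {n} (j : Fin n) → j ∉ allFinExcept j
∉-allFinExcept {suc n} j j∈ with _ , _ , eq ← ∈.∈-map⁻ (punchIn j) j∈ = F.punchInᵢ≢i j _ (sym eq)

length-allFinExcept : ∀ {n} (j : Fin n) → 1 + length (allFinExcept j) ≡ n
length-allFinExcept {suc n} j =
  cong suc (trans (List.length-map (punchIn j) (allFin n)) (List.length-tabulate {n = n} (λ k → k)))

allFinExcept₂ : ∀ {n} {i j : Fin n} → i ≢ j → List (Fin n)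
allFinExcept₂ {suc n} {i} i≢j = map (punchIn i) (allFinExcept (punchOut i≢j))

allFinExcept₂-unique : ∀ {n} {i j : Fin n} (i≢j : i ≢ j) → Unique (allFinExcept₂ i≢j)
allFinExcept₂-unique {suc n} {i} i≢j = Unique.map⁺ (F.punchIn-injective i _ _) (allFinExcept-unique (punchOut i≢j))

∉-allFinExcept₂ˡ : ∀ {n} {i j : Fin n} (i≢j : i ≢ j) → i ∉ allFinExcept₂ i≢j
∉-allFinExcept₂ˡ {suc n} {i} i≢j i∈ with _ , _ , eq ← ∈.∈-map⁻ (punchIn i) i∈ = F.punchInᵢ≢i i _ (sym eq)

∉-allFinExcept₂ʳ : ∀ {n} {i j : Fin n} (i≢j : i ≢ j) → j ∉ allFinExcept₂ i≢j
∉-allFinExcept₂ʳ {suc n} {i} i≢j j∈ with k , k∈ , eq ← ∈.∈-map⁻ (punchIn i) j∈ =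
  ∉-allFinExcept (punchOut i≢j)
    (subst (_∈ _) (F.punchIn-injective i k _ (trans (sym eq) (sym (F.punchIn-punchOut i≢j)))) k∈)

length-allFinExcept₂ : ∀ {n} {i j : Fin n} (i≢j : i ≢ j) → 2 + length (allFinExcept₂ i≢j) ≡ n
length-allFinExcept₂ {suc n} {i} i≢j = cong suc (trans
  (cong suc (List.length-map (punchIn i) (allFinExcept (punchOut i≢j))))
  (length-allFinExcept (punchOut i≢j)))

-- Routes inside the first and last block

lapOrder : List Colour
lapOrder = odd₀ ∷ even₁ ∷ odd₁ ∷ even₂ ∷ odd₂ ∷ []

-- A path from block i to block j ≠ i (or back to i) traverses P in block i starting at c, every
-- other block in lapOrder (from odd₀ to odd₂), and S in block j ending at d. The three Connected
-- conditions make the joins work whether zero or more blocks lie in between.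
Route : Colour → Colour → List Colour → List Colour → Set
Route c d P S =
  head P ≡ just c × last S ≡ just d × Linked Edge P × Linked Edge S ×
  Connected Edge (last P) (just odd₀) × Connected Edge (just odd₂) (head S) × Connected Edge (last P) (head S) ×
  Unique P × Unique S

route? : ∀ c d P S → Dec (Route c d P S)
route? c d P S =
  Maybe.≡-dec _≟_ (head P) (just c) ×-dec Maybe.≡-dec _≟_ (last S) (just d) ×-dec
  linked? edge? P ×-dec linked? edge? S ×-dec
  connected? edge? (last P) (just odd₀) ×-dec connected? edge? (just odd₂) (head S) ×-dec
  connected? edge? (last P) (head S) ×-dec
  unique? P ×-dec unique? S

fullFrom : Colour → List Colour
fullFrom even₁ = even₁ ∷ odd₀ ∷ even₂ ∷ odd₁ ∷ odd₂ ∷ []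
fullFrom even₂ = even₂ ∷ odd₀ ∷ even₁ ∷ odd₁ ∷ odd₂ ∷ []
fullFrom odd₀  = odd₀ ∷ even₁ ∷ odd₁ ∷ even₂ ∷ odd₂ ∷ []
fullFrom odd₁  = odd₁ ∷ even₁ ∷ odd₀ ∷ even₂ ∷ odd₂ ∷ []
fullFrom odd₂  = odd₂ ∷ even₁ ∷ odd₀ ∷ even₂ ∷ odd₁ ∷ []

fullTo : Colour → List Colour
fullTo even₁ = odd₀ ∷ even₂ ∷ odd₁ ∷ odd₂ ∷ even₁ ∷ []
fullTo even₂ = odd₀ ∷ even₁ ∷ odd₁ ∷ odd₂ ∷ even₂ ∷ []
fullTo odd₀  = even₁ ∷ odd₁ ∷ even₂ ∷ odd₂ ∷ odd₀ ∷ []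
fullTo odd₁  = even₁ ∷ odd₀ ∷ even₂ ∷ odd₂ ∷ odd₁ ∷ []
fullTo odd₂  = even₁ ∷ odd₀ ∷ even₂ ∷ odd₁ ∷ odd₂ ∷ []

SeparateRoute : Colour → Colour → Set
SeparateRoute c d = Route c d (fullFrom c) (fullTo d) × length (fullFrom c) + length (fullTo d) ≡ 5 * 2

separateRoute : ∀ c d → SeparateRoute c d
separateRoute c d = All.lookup (All.lookup table (∈-colours c)) (∈-colours d)
  where
  table : All (λ c → All (SeparateRoute c) colours) colours
  table = toWitness {a? = all? (λ c → all? (λ d → route? c d _ _ ×-dec (_ ℕ.≟ _)) colours) colours} _

-- The last clause is the case c ≡ d, which never occurs.
split : Colour → Colour → List Colour × List Colour
split even₁ even₂ = even₁ ∷ odd₀ ∷ odd₁ ∷ odd₂ ∷ [] , even₂ ∷ []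
split even₁ odd₀  = even₁ ∷ odd₁ ∷ [] , even₂ ∷ odd₂ ∷ odd₀ ∷ []
split even₁ odd₁  = even₁ ∷ odd₀ ∷ odd₂ ∷ [] , even₂ ∷ odd₁ ∷ []
split even₁ odd₂  = even₁ ∷ odd₀ ∷ odd₁ ∷ [] , even₂ ∷ odd₂ ∷ []
split even₂ even₁ = even₂ ∷ odd₀ ∷ odd₁ ∷ odd₂ ∷ [] , even₁ ∷ []
split even₂ odd₀  = even₂ ∷ odd₁ ∷ [] , even₁ ∷ odd₂ ∷ odd₀ ∷ []
split even₂ odd₁  = even₂ ∷ odd₀ ∷ odd₂ ∷ [] , even₁ ∷ odd₁ ∷ []
split even₂ odd₂  = even₂ ∷ odd₀ ∷ odd₁ ∷ [] , even₁ ∷ odd₂ ∷ []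
split odd₀  even₁ = odd₀ ∷ even₂ ∷ odd₁ ∷ odd₂ ∷ [] , even₁ ∷ []
split odd₀  even₂ = odd₀ ∷ even₁ ∷ odd₁ ∷ odd₂ ∷ [] , even₂ ∷ []
split odd₀  odd₁  = odd₀ ∷ even₁ ∷ odd₂ ∷ [] , even₂ ∷ odd₁ ∷ []
split odd₀  odd₂  = odd₀ ∷ even₁ ∷ odd₁ ∷ [] , even₂ ∷ odd₂ ∷ []
split odd₁  even₁ = odd₁ ∷ [] , even₂ ∷ odd₀ ∷ odd₂ ∷ even₁ ∷ []
split odd₁  even₂ = odd₁ ∷ [] , even₁ ∷ odd₀ ∷ odd₂ ∷ even₂ ∷ []
split odd₁  odd₀  = odd₁ ∷ [] , even₁ ∷ odd₂ ∷ even₂ ∷ odd₀ ∷ []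
split odd₁  odd₂  = odd₁ ∷ [] , even₁ ∷ odd₀ ∷ even₂ ∷ odd₂ ∷ []
split odd₂  even₁ = odd₂ ∷ [] , even₂ ∷ odd₀ ∷ odd₁ ∷ even₁ ∷ []
split odd₂  even₂ = odd₂ ∷ [] , even₁ ∷ odd₀ ∷ odd₁ ∷ even₂ ∷ []
split odd₂  odd₀  = odd₂ ∷ [] , even₁ ∷ odd₁ ∷ even₂ ∷ odd₀ ∷ []
split odd₂  odd₁  = odd₂ ∷ [] , even₁ ∷ odd₀ ∷ even₂ ∷ odd₁ ∷ []
split c     _     = c ∷ [] , []

SharedRoute : Colour → Colour → Set
SharedRoute c d = let P , S = split c d in Route c d P S × Disjoint P S × length P + length S ≡ 5 * 1

sharedRoute : ∀ {c d} → c ≢ d → SharedRoute c d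
sharedRoute {c} {d} c≢d = [ ⊥-elim ∘ c≢d , (λ route → route) ]′ (All.lookup (All.lookup table (∈-colours c)) (∈-colours d))
  where
  table : All (λ c → All (λ d → c ≡ d ⊎ SharedRoute c d) colours) colours
  table = toWitness {a? = all? (λ c → all? (λ d → c ≟ d ⊎-dec (route? c d _ _ ×-dec disjoint? _ _ ×-dec (_ ℕ.≟ _))) colours) colours} _

-- Hamiltonian paths

module _ {n : ℕ} where

  EdgeN : Node n → Node n → Set
  EdgeN = Edge on proj₂

  block : Fin n → List Colour → List (Node n)
  block k = map (k ,_)

  laps : List (Fin n) → List (Node n) → List (Node n)
  laps []       rest = rest
  laps (k ∷ ks) rest = block k lapOrder ++ laps ks rest

  tour : Fin n → List Colour → List (Fin n) → Fin n → List Colour → List (Node n)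
  tour i P ks j S = block i P ++ laps ks (block j S)

  block-linked : ∀ {k cs} → Linked Edge cs → Linked EdgeN (block k cs)
  block-linked = Linked.map⁺

  block-connected : ∀ {k l mc md} → Connected Edge mc md → Connected EdgeN (Maybe.map (k ,_) mc) (Maybe.map (l ,_) md)
  block-connected (just e)     = just e
  block-connected just-nothing = just-nothing
  block-connected nothing-just = nothing-just
  block-connected nothing      = nothing

  laps-linked : ∀ ks {rest} → Linked EdgeN rest → (∀ {k} → Connected EdgeN (just (k , odd₂)) (head rest)) →
                Linked EdgeN (laps ks rest)
  laps-linked []       linked enter = linked
  laps-linked (k ∷ ks) {rest} linked enter =
    Linked.++⁺ (block-linked (toWitness {a? = linked? edge? lapOrder} _)) (exit ks) (laps-linked ks linked enter)
    where
    exit : ∀ ks → Connected EdgeN (just (k , odd₂)) (head (laps ks rest))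
    exit []      = enter
    exit (_ ∷ _) = just (λ ())

  tour-linked : ∀ {c d P S} i ks j → Route c d P S → Linked EdgeN (tour i P ks j S)
  tour-linked {P = P} {S} i ks j (_ , _ , linkedP , linkedS , exitP , enterS , bridge , _) =
    Linked.++⁺ (block-linked linkedP) (junction ks) (laps-linked ks (block-linked linkedS) enter)
    where
    enter : ∀ {k} → Connected EdgeN (just (k , odd₂)) (head (block j S))
    enter = subst (Connected EdgeN _) (sym (List.head-map S)) (block-connected enterS)
    junction : ∀ ks → Connected EdgeN (last (block i P)) (head (laps ks (block j S)))
    junction []      = subst₂ (Connected EdgeN) (sym (List.last-map (i ,_) P)) (sym (List.head-map S)) (block-connected bridge)
    junction (_ ∷ _) = subst (λ m → Connected EdgeN m _) (sym (List.last-map (i ,_) P)) (block-connected exitP)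

  ∈-block⁻ : ∀ {k cs x} → x ∈ block k cs → proj₁ x ≡ k × proj₂ x ∈ cs
  ∈-block⁻ {k} x∈ with _ , c∈ , refl ← ∈.∈-map⁻ (k ,_) x∈ = refl , c∈

  block-unique : ∀ {k cs} → Unique cs → Unique (block k cs)
  block-unique = Unique.map⁺ (cong proj₂)

  block-disjoint : ∀ {k P S} → Disjoint P S → Disjoint (block k P) (block k S)
  block-disjoint disjointPS (x∈P , x∈S) = disjointPS (proj₂ (∈-block⁻ x∈P) , proj₂ (∈-block⁻ x∈S))

  blocks-disjoint : ∀ {k l P S} → k ≢ l → Disjoint (block k P) (block l S)
  blocks-disjoint k≢l (x∈P , x∈S) = k≢l (trans (sym (proj₁ (∈-block⁻ x∈P))) (proj₁ (∈-block⁻ x∈S)))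

  ∈-laps⁻ : ∀ ks {rest x} → x ∈ laps ks rest → proj₁ x ∈ ks ⊎ x ∈ rest
  ∈-laps⁻ []       x∈ = inj₂ x∈
  ∈-laps⁻ (k ∷ ks) x∈ with ∈.∈-++⁻ (block k lapOrder) x∈
  ... | inj₁ x∈block = inj₁ (here (proj₁ (∈-block⁻ x∈block)))
  ... | inj₂ x∈laps  = map₁ there (∈-laps⁻ ks x∈laps)

  laps-unique : ∀ {ks rest} → Unique ks → Unique rest → (∀ {x} → x ∈ rest → proj₁ x ∉ ks) → Unique (laps ks rest)
  laps-unique {[]}     _          unique-rest _     = unique-rest
  laps-unique {k ∷ ks} (k∉ks ∷ u) unique-rest fresh =
    Unique.++⁺ (block-unique (toWitness {a? = unique? lapOrder} _)) (laps-unique u unique-rest (λ x∈ → fresh x∈ ∘ there)) disjoint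
    where
    disjoint : Disjoint (block k lapOrder) (laps ks _)
    disjoint (x∈block , x∈laps) with ∈-laps⁻ ks x∈laps | proj₁ (∈-block⁻ x∈block)
    ... | inj₁ k∈ks   | refl = All.lookup k∉ks k∈ks refl
    ... | inj₂ x∈rest | refl = fresh x∈rest (here refl)

  tour-unique : ∀ {P S ks} i j → Unique P → Unique S → Disjoint (block i P) (block j S) →
                Unique ks → i ∉ ks → j ∉ ks → Unique (tour i P ks j S)
  tour-unique {P} {S} {ks} i j uniqueP uniqueS disjointPS uniqueks i∉ks j∉ks =
    Unique.++⁺ (block-unique uniqueP) (laps-unique uniqueks (block-unique uniqueS) freshS) disjoint
    where
    freshS : ∀ {x} → x ∈ block j S → proj₁ x ∉ ks
    freshS x∈ rewrite proj₁ (∈-block⁻ x∈) = j∉ks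
    disjoint : Disjoint (block i P) (laps ks (block j S))
    disjoint (x∈P , x∈laps) with ∈-laps⁻ ks x∈laps
    ... | inj₁ i∈ks rewrite proj₁ (∈-block⁻ x∈P) = i∉ks i∈ks
    ... | inj₂ x∈S = disjointPS (x∈P , x∈S)

  head-tour : ∀ {c P} i ks j S → head P ≡ just c → head (tour i P ks j S) ≡ just (i , c)
  head-tour {P = _ ∷ _} i ks j S refl = refl

  last-tour : ∀ {d S} i P ks j → last S ≡ just d → last (tour i P ks j S) ≡ just (j , d)
  last-tour {S = S} i P ks j eq =
    last-++ (block i P) (last-laps ks (trans (List.last-map (j ,_) S) (cong (Maybe.map _) eq)))
    where
    last-laps : ∀ ks {rest y} → last rest ≡ just y → last (laps ks rest) ≡ just y
    last-laps []       eq = eq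
    last-laps (k ∷ ks) {rest} eq = last-++ (block k lapOrder) {laps ks rest} (last-laps ks eq)

  length-laps : ∀ ks rest → length (laps ks rest) ≡ 5 * length ks + length rest
  length-laps []       rest = refl
  length-laps (k ∷ ks) rest = begin
    5 + length (laps ks rest)          ≡⟨ cong (5 +_) (length-laps ks rest) ⟩
    5 + (5 * length ks + length rest)  ≡⟨ ℕ.+-assoc 5 (5 * length ks) (length rest) ⟨
    5 + 5 * length ks + length rest    ≡⟨ cong (_+ length rest) (ℕ.*-suc 5 (length ks)) ⟨
    5 * suc (length ks) + length rest  ∎
    where open ≡-Reasoning

  length-tour : ∀ i P ks j S → length (tour i P ks j S) ≡ length P + length S + 5 * length ks
  length-tour i P ks j S = begin
    length (block i P ++ laps ks (block j S))          ≡⟨ List.length-++ (block i P) ⟩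
    length (block i P) + length (laps ks (block j S))  ≡⟨ cong₂ _+_ (List.length-map (i ,_) P) (length-laps ks (block j S)) ⟩
    length P + (5 * length ks + length (block j S))    ≡⟨ cong (λ e → length P + (5 * length ks + e)) (List.length-map (j ,_) S) ⟩
    length P + (5 * length ks + length S)              ≡⟨ regroup (length P) (5 * length ks) (length S) ⟩
    length P + length S + 5 * length ks                ∎
    where
    open ≡-Reasoning
    regroup : ∀ a b c → a + (b + c) ≡ a + c + b
    regroup = solve-∀

  tour-path : ∀ {c d P S ks} i j → Route c d P S → Disjoint (block i P) (block j S) →
              Unique ks → i ∉ ks → j ∉ ks → Path (embed (i , c)) (embed (j , d)) (map embed (tour i P ks j S))
  tour-path {P = P} {S} {ks} i j route@(startP , endS , _ , _ , _ , _ , _ , uniqueP , uniqueS)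
            disjointPS uniqueks i∉ks j∉ks =
    linked⇒walk (Linked.map⁺ (Linked.map embed-adjacent (tour-linked i ks j route)))
      (trans (List.head-map tour′) (cong (Maybe.map embed) (head-tour i ks j S startP)))
      (trans (List.last-map embed tour′) (cong (Maybe.map embed) (last-tour i P ks j endS))) ,
    Unique.map⁺ embed-injective (tour-unique i j uniqueP uniqueS disjointPS uniqueks i∉ks j∉ks) ,
    All.map⁺ (All.universal embed-vertex tour′)
    where
    tour′ = tour i P ks j S

  tour-hamiltonian : ∀ {c d} i j P S ks t → Route c d P S → Disjoint (block i P) (block j S) →
                     length P + length S ≡ 5 * t → Unique ks → i ∉ ks → j ∉ ks → t + length ks ≡ n →
                     ∃ λ ps → Path (embed (i , c)) (embed (j , d)) ps × length ps ≡ 5 * n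
  tour-hamiltonian i j P S ks t route disjointPS lengthPS uniqueks i∉ks j∉ks count =
    map embed (tour i P ks j S) , tour-path i j route disjointPS uniqueks i∉ks j∉ks , (begin
      length (map embed (tour i P ks j S))  ≡⟨ List.length-map embed (tour i P ks j S) ⟩
      length (tour i P ks j S)              ≡⟨ length-tour i P ks j S ⟩
      length P + length S + 5 * length ks   ≡⟨ cong (_+ 5 * length ks) lengthPS ⟩
      5 * t + 5 * length ks                 ≡⟨ ℕ.*-distribˡ-+ 5 t (length ks) ⟨
      5 * (t + length ks)                   ≡⟨ cong (5 *_) count ⟩
      5 * n                                 ∎)
    where open ≡-Reasoning

  hamiltonian : ∀ {x y : Node n} → x ≢ y → ∃ λ ps → Path (embed x) (embed y) ps × length ps ≡ 5 * n
  hamiltonian {i , c} {j , d} x≢y with i F.≟ j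
  ... | yes refl =
    let route , disjointPS , lengthPS = sharedRoute c≢d in
    tour-hamiltonian i i _ _ (allFinExcept i) 1 route (block-disjoint disjointPS) lengthPS
      (allFinExcept-unique i) (∉-allFinExcept i) (∉-allFinExcept i) (length-allFinExcept i)
    where
    c≢d : c ≢ d
    c≢d refl = x≢y refl
  ... | no i≢j =
    let route , lengthPS = separateRoute c d in
    tour-hamiltonian i j (fullFrom c) (fullTo d) (allFinExcept₂ i≢j) 2 route (blocks-disjoint i≢j) lengthPS
      (allFinExcept₂-unique i≢j) (∉-allFinExcept₂ˡ i≢j) (∉-allFinExcept₂ʳ i≢j) (length-allFinExcept₂ i≢j)

-- Detour distances and the detour index polynomial

offset : Colour → ℕ
offset c = toℕ (aParity c) * 3 + toℕ (bExp c)

offset<6 : ∀ c → offset c < 6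
offset<6 c = All.lookup (toWitness {a? = all? (λ c → offset c ℕ.<? 6) colours} _) (∈-colours c)

rank-embed : ∀ {n} (x : Node n) → rank (embed x) ≡ 6 * toℕ (proj₁ x) + offset (proj₂ x)
rank-embed (k , c) = begin
  toℕ (aIndex k (aParity c)) * 3 + toℕ (bExp c)     ≡⟨ cong (λ e → e * 3 + toℕ (bExp c)) (toℕ-aIndex k (aParity c)) ⟩
  (2 * toℕ k + toℕ (aParity c)) * 3 + toℕ (bExp c) ≡⟨ regroup (toℕ k) (toℕ (aParity c)) (toℕ (bExp c)) ⟩
  6 * toℕ k + offset c                              ∎
  where
  open ≡-Reasoning
  regroup : ∀ k r j → (2 * k + r) * 3 + j ≡ 6 * k + (r * 3 + j)
  regroup = solve-∀

nodes : ∀ n → List (Node n)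
nodes n = cartesianProduct (allFin n) colours

vertices : ∀ n → List (U n)
vertices n = map embed (nodes n)

RankOrdered : ∀ {n} → U n → U n → Set
RankOrdered = _<_ on rank

vertices-sorted : ∀ n → AllPairs RankOrdered (vertices n)
vertices-sorted n = AllPairs.map⁺ (AllPairs-cartesianProduct⁺ across within
  (AllPairs.tabulate⁺-< (λ k<l → k<l)) (toWitness {a? = allPairs? (λ c d → offset c ℕ.<? offset d) colours} _))
  where
  across : ∀ {k l : Fin n} {c d} → toℕ k < toℕ l → RankOrdered (embed (k , c)) (embed (l , d))
  across {k} {l} {c} {d} k<l rewrite rank-embed (k , c) | rank-embed (l , d) = begin-strict
    6 * toℕ k + offset c  <⟨ ℕ.+-monoʳ-< (6 * toℕ k) (offset<6 c) ⟩
    6 * toℕ k + 6         ≡⟨ ℕ.+-comm (6 * toℕ k) 6 ⟩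
    6 + 6 * toℕ k         ≡⟨ ℕ.*-suc 6 (toℕ k) ⟨
    6 * suc (toℕ k)       ≤⟨ ℕ.*-monoʳ-≤ 6 k<l ⟩
    6 * toℕ l             ≤⟨ ℕ.m≤m+n (6 * toℕ l) (offset d) ⟩
    6 * toℕ l + offset d  ∎
    where open ℕ.≤-Reasoning
  within : ∀ {k : Fin n} {c d} → offset c < offset d → RankOrdered (embed (k , c)) (embed (k , d))
  within {k} {c} {d} c<d rewrite rank-embed (k , c) | rank-embed (k , d) = ℕ.+-monoʳ-< (6 * toℕ k) c<d

∈-vertices : ∀ {n} {g : U n} → Vertex g → g ∈ vertices n
∈-vertices noncentral with (k , c) , refl ← embed-surjective noncentral =
  ∈.∈-map⁺ embed (∈.∈-cartesianProduct⁺ (∈.∈-allFin k) (∈-colours c))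

vertices-vertex : ∀ n → All Vertex (vertices n)
vertices-vertex n = All.map⁺ (All.universal embed-vertex (nodes n))

length-vertices : ∀ n → length (vertices n) ≡ 5 * n
length-vertices n = begin
  length (map embed (nodes n))  ≡⟨ List.length-map embed (nodes n) ⟩
  length (nodes n)              ≡⟨ length-cartesianProduct (allFin n) colours ⟩
  length (allFin n) * 5         ≡⟨ cong (_* 5) (List.length-tabulate {n = n} (λ k → k)) ⟩
  n * 5                         ≡⟨ ℕ.*-comm n 5 ⟩
  5 * n                         ∎
  where open ≡-Reasoning

path-length≤ : ∀ {n} {u v : U n} {ps} → Path u v ps → length ps ≤ 5 * n
path-length≤ {n} {ps = ps} (_ , unique , allVertex) =
  subst (length ps ≤_) (length-vertices n) (Unique⇒length-mono-⊆ unique (λ g∈ → ∈-vertices (All.lookup allVertex g∈)))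

detour-hamiltonian : ∀ {n} {u v : U n} → Vertex u → Vertex v → u ≢ v → DetourDist u v (5 * n ∸ 1)
detour-hamiltonian vu vv u≢v with x , refl ← embed-surjective vu | y , refl ← embed-surjective vv
  with ps , path , length≡ ← hamiltonian (u≢v ∘ cong embed) =
  (ps , path , cong (_∸ 1) length≡) , λ _ path′ → ℕ.∸-monoˡ-≤ 1 (path-length≤ path′)

DetourDist-unique : ∀ {n} {u v : U n} {k l} → DetourDist u v k → DetourDist u v l → k ≡ l
DetourDist-unique ((ps , path , refl) , longest) ((qs , path′ , refl) , longest′) =
  ℕ.≤-antisym (longest′ ps path) (longest qs path′)

vertexPair-≢ : ∀ {n} {u v : U n} → VertexPair (u , v) → u ≢ v
vertexPair-≢ (_ , _ , u<v) refl = ℕ.<-irrefl refl u<v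

detourCoeff-max : ∀ n → DetourCoeff n (5 * n ∸ 1) ((5 * n * (5 * n ∸ 1)) / 2)
detourCoeff-max n =
  pairs (vertices n) , pairs-unique {R = RankOrdered} (λ {u v} → asym {u} {v}) (vertices-sorted n) , count , λ _ → mk⇔ to from
  where
  asym : Asymmetric (RankOrdered {n})
  asym {u} {v} = ℕ.<-asym {rank u} {rank v}
  count : length (pairs (vertices n)) ≡ (5 * n * (5 * n ∸ 1)) / 2
  count = begin
    length (pairs (vertices n))  ≡⟨ length-pairs (vertices n) ⟩
    length (vertices n) C 2      ≡⟨ cong (_C 2) (length-vertices n) ⟩
    5 * n C 2                    ≡⟨ m*n/n≡m (5 * n C 2) 2 ⟨
    ((5 * n C 2) * 2) / 2        ≡⟨ cong (_/ 2) (nC2*2≡n*[n∸1] (5 * n)) ⟩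
    (5 * n * (5 * n ∸ 1)) / 2    ∎
    where open ≡-Reasoning
  to : ∀ {p} → p ∈ pairs (vertices n) → VertexPair p × DetourDist (proj₁ p) (proj₂ p) (5 * n ∸ 1)
  to p∈ with u∈ , v∈ , u<v ← ∈-pairs⁻ (vertices-sorted n) p∈ =
    let vu = All.lookup (vertices-vertex n) u∈ ; vv = All.lookup (vertices-vertex n) v∈ in
    (vu , vv , u<v) , detour-hamiltonian vu vv (vertexPair-≢ (vu , vv , u<v))
  from : ∀ {p} → VertexPair p × DetourDist (proj₁ p) (proj₂ p) (5 * n ∸ 1) → p ∈ pairs (vertices n)
  from ((vu , vv , u<v) , _) = ∈-pairs⁺ {R = RankOrdered} (λ {u v} → asym {u} {v}) (vertices-sorted n) (∈-vertices vu) (∈-vertices vv) u<v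

detourCoeff-other : ∀ n k → k ≢ 5 * n ∸ 1 → DetourCoeff n k 0
detourCoeff-other n k k≢ = [] , [] , refl , λ _ → mk⇔ (λ ()) λ (pair@(vu , vv , _) , detourₖ) →
  ⊥-elim (k≢ (DetourDist-unique detourₖ (detour-hamiltonian vu vv (vertexPair-≢ pair))))

theorem4p2 : (n : ℕ) → 1 ≤ n →
    DetourCoeff n (5 * n ∸ 1) ((5 * n * (5 * n ∸ 1)) / 2) ×
    (∀ k → k ≢ 5 * n ∸ 1 → DetourCoeff n k 0)
theorem4p2 n _ = detourCoeff-max n , detourCoeff-other n
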